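{- Let $n\ge2$, $f\in\mathfrak{T}(2,n)$, $i\in\{0,1\}$, and let $l$ be an $i$-separation line of $f$. Then $\textup{Vert}(\textup{Conv}(l\cap E_n^2))\subseteq S_i(f)$.
   Context: $E_n^2=\{0,\dots,n-1\}^2$, $M_\nu(f)=\{x\in E_n^2: f(x)=\nu\}$. $\mathfrak{T}(2,n)$ is the class of threshold functions $f:E_n^2\to\{0,1\}$, i.e. $M_1(f)=\{x\in E_n^2: a_1x_1+a_2x_2\le a_0\}$ for some reals $a_0,a_1,a_2$. For $i\in\{0,1\}$, a line $a_1x_1+a_2x_2=a_0$ (reals, $(a_1,a_2)\ne(0,0)$) is an $i$-separation line of $f$ if for all $x\in E_n^2$: $x\in M_i(f)\iff a_1x_1+a_2x_2\le a_0$. $S(f)$ is the set of essential points of $f$ with respect to $\mathfrak{T}(2,n)$ (points $x$ such that some $g\in\mathfrak{T}(2,n)$ differs from $f$ exactly at $x$), and $S_i(f)=S(f)\cap M_i(f)$. $\textup{Vert}$ denotes the vertex set of a convex set (a point or segment here).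
   Formalization: The coefficients of the separation line l and of the threshold functions in $\mathfrak{T}(2,n)$ are rational rather than real. -}

module Defs where

open import Data.Nat using (ℕ)
open import Data.Fin using (Fin; toℕ)
open import Data.Product using (Σ; ∃; _×_; _,_)
open import Data.Integer using (+_)
open import Data.Rational using (ℚ; _+_; _*_; _-_; _≤_; _<_; 0ℚ; 1ℚ; _/_)
open import Relation.Binary.PropositionalEquality using (_≡_; _≢_)
open import Relation.Nullary using (¬_)

Point : ℕ → Set
Point n = Fin n × Fin n

Fun2 : ℕ → Set
Fun2 n = Point n → Fin 2

coord : {n : ℕ} → Fin n → ℚ
coord k = (+ toℕ k) / 1

lin : {n : ℕ} → ℚ → ℚ → Point n → ℚ
lin a1 a2 (x1 , x2) = a1 * coord x1 + a2 * coord x2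

IsThreshold : {n : ℕ} → Fun2 n → Set
IsThreshold {n} f = Σ ℚ λ a0 → Σ ℚ λ a1 → Σ ℚ λ a2 →
  (x : Point n) → (f x ≡ Fin.suc Fin.zero → lin a1 a2 x ≤ a0)
                × (lin a1 a2 x ≤ a0 → f x ≡ Fin.suc Fin.zero)
  where import Data.Fin as Fin

record Line : Set where
  constructor line
  field
    a0 a1 a2 : ℚ
    nondeg : ¬ (a1 ≡ 0ℚ × a2 ≡ 0ℚ)
open Line public

IsSepLine : {n : ℕ} → Fin 2 → Fun2 n → Line → Set
IsSepLine {n} i f l = (x : Point n) →
  (f x ≡ i → lin (a1 l) (a2 l) x ≤ a0 l) × (lin (a1 l) (a2 l) x ≤ a0 l → f x ≡ i)

OnLine : {n : ℕ} → Line → Point n → Set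
OnLine l x = lin (a1 l) (a2 l) x ≡ a0 l

Essential : {n : ℕ} → Fun2 n → Point n → Set
Essential {n} f x = Σ (Fun2 n) λ g → IsThreshold g
  × ((y : Point n) → y ≢ x → g y ≡ f y) × (g x ≢ f x)

InS : {n : ℕ} → Fun2 n → Fin 2 → Point n → Set
InS f i x = Essential f x × f x ≡ i

StrictlyBetween : {n : ℕ} → Point n → Point n → Point n → Set
StrictlyBetween (x1 , x2) (y1 , y2) (z1 , z2) = ¬ ((y1 , y2) ≡ (z1 , z2)) ×
  Σ ℚ λ t → (0ℚ < t) × (t < 1ℚ)
    × (coord x1 ≡ t * coord y1 + (1ℚ - t) * coord z1)
    × (coord x2 ≡ t * coord y2 + (1ℚ - t) * coord z2)

-- x ∈ Vert(Conv(l ∩ E_n^2)): the finite set l ∩ E_n^2 is collinear, so its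
-- convex hull is a point or a segment, whose vertices are exactly the points
-- of l ∩ E_n^2 not lying strictly between two points of l ∩ E_n^2.
IsVertex : {n : ℕ} → Line → Point n → Set
IsVertex {n} l x = OnLine l x ×
  ¬ (Σ (Point n) λ y → Σ (Point n) λ z → OnLine l y × OnLine l z × StrictlyBetween x y z)

{-# OPTIONS --safe #-}

-- Let φ be the coordinate along l measured from the vertex x. Because x is not
-- strictly between two points of l ∩ E_n^2, φ has constant sign on the rest of
-- l ∩ E_n^2; orient it so that φ > 0 there. Since E_n^2 is finite, there is c′
-- with c′φ > 1 on l ∩ E_n^2 ∖ {x}, and then c so large that the affine function
-- h = c (a₁x₁ + a₂x₂ − a₀) + (1 − c′φ) has the sign of a₁x₁ + a₂x₂ − a₀ off l.
-- Thus h < 0 on M_i(f) ∖ {x}, h > 0 on M_{1−i}(f) and h(x) = 1, so the threshold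
-- function cut out by h differs from f exactly at x.
module Submission where

open import Defs
open import Data.Nat using (ℕ; _≤_)
open import Data.Fin using (Fin)

open import Data.Empty using (⊥; ⊥-elim)
open import Data.Fin using (zero; suc; toℕ)
open import Data.Fin.Properties using (toℕ-injective; any?; 0≢1+n) renaming (_≟_ to _≟ᶠ_)
import Data.Nat.Properties as ℕₚ
open import Data.Product using (Σ; ∃; _×_; _,_; proj₁; proj₂)
open import Data.Rational
  using (ℚ; 0ℚ; 1ℚ; _+_; _*_; _-_; -_; 1/_; _⊔_; _<_; Positive; NonZero;
         positive; negative; nonNegative; nonPositive; ≢-nonZero)
  renaming (_≤_ to _≤ℚ_)
open import Data.Rational.Properties
open import Algebra.Properties.Group +-0-group using ()
  renaming (x∙y⁻¹≈ε⇒x≈y to p-q≡0⇒p≡q; x≈y⇒x∙y⁻¹≈ε to p≡q⇒p-q≡0)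
open import Data.Rational.Solver using (module +-*-Solver)
open import Data.Sum using (_⊎_; inj₁; inj₂; [_,_]′)
open import Function using (_∘_)
open import Relation.Binary.Definitions using (tri<; tri≈; tri>)
open import Relation.Binary.PropositionalEquality
open import Relation.Nullary using (¬_; Dec; yes; no)
open import Relation.Nullary.Decidable using (map′; _×-dec_)
open +-*-Solver using (solve; _:=_; con; _:+_; _:*_; _:-_; :-_)
open ≡-Reasoning

p-q+q≡p : ∀ p q → p - q + q ≡ p
p-q+q≡p = solve 2 (λ p q → p :- q :+ q := p) refl

p<q⇒p-q<0 : ∀ {p q} → p < q → p - q < 0ℚ
p<q⇒p-q<0 {p} {q} p<q = subst (p - q <_) (+-inverseʳ q) (+-monoˡ-< (- q) p<q)

p<q⇒0<q-p : ∀ {p q} → p < q → 0ℚ < q - p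
p<q⇒0<q-p {p} {q} p<q = subst (_< q - p) (+-inverseʳ p) (+-monoˡ-< (- p) p<q)

p-q<0⇒p<q : ∀ {p q} → p - q < 0ℚ → p < q
p-q<0⇒p<q {p} {q} p-q<0 = subst₂ _<_ (p-q+q≡p p q) (+-identityˡ q) (+-monoˡ-< q p-q<0)

0<p-q⇒q<p : ∀ {p q} → 0ℚ < p - q → q < p
0<p-q⇒q<p {p} {q} 0<p-q = subst₂ _<_ (+-identityˡ q) (p-q+q≡p p q) (+-monoˡ-< q 0<p-q)

≤⇒<⊎≡ : ∀ {p q} → p ≤ℚ q → p < q ⊎ p ≡ q
≤⇒<⊎≡ {p} {q} p≤q with <-cmp p q
... | tri< p<q _ _ = inj₁ p<q
... | tri≈ _ p≡q _ = inj₂ p≡q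
... | tri> _ _ q<p = ⊥-elim (<-irrefl refl (<-≤-trans q<p p≤q))

*-cancelˡ-≡-pos : ∀ r .{{_ : Positive r}} {p q} → r * p ≡ r * q → p ≡ q
*-cancelˡ-≡-pos r rp≡rq =
  ≤-antisym (*-cancelˡ-≤-pos r (≤-reflexive rp≡rq)) (*-cancelˡ-≤-pos r (≤-reflexive (sym rp≡rq)))

zero-combination : ∀ p q {d e} → d ≡ 0ℚ → e ≡ 0ℚ → p * d + q * e ≡ 0ℚ
zero-combination p q refl refl = cong₂ _+_ (*-zeroʳ p) (*-zeroʳ q)

p≢0⇒0<p*p : ∀ p → p ≢ 0ℚ → 0ℚ < p * p
p≢0⇒0<p*p p p≢0 with <-cmp p 0ℚ
... | tri< p<0 _ _ = positive⁻¹ (p * p) {{neg*neg⇒pos p {{negative p<0}} p {{negative p<0}}}}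
... | tri≈ _ p≡0 _ = ⊥-elim (p≢0 p≡0)
... | tri> _ _ 0<p = positive⁻¹ (p * p) {{pos*pos⇒pos p {{positive 0<p}} p {{positive 0<p}}}}

0≤p*p : ∀ p → 0ℚ ≤ℚ p * p
0≤p*p p with p ≟ 0ℚ
... | yes refl = ≤-refl
... | no p≢0   = <⇒≤ (p≢0⇒0<p*p p p≢0)

0<p*p+q*q : ∀ {p q} → ¬ (p ≡ 0ℚ × q ≡ 0ℚ) → 0ℚ < p * p + q * q
0<p*p+q*q {p} {q} ¬p≡q≡0 with p ≟ 0ℚ
... | yes p≡0 = +-mono-≤-< (0≤p*p p) (p≢0⇒0<p*p q (¬p≡q≡0 ∘ (p≡0 ,_)))
... | no p≢0   = +-mono-<-≤ (p≢0⇒0<p*p p p≢0) (0≤p*p q)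

coord-injective : ∀ {n} {j k : Fin n} → coord j ≡ coord k → j ≡ k
coord-injective {j = j} {k} eq = toℕ-injective (trans (sym (ℕₚ.*-identityʳ (toℕ j)))
  (trans (normalize-injective-≃ (toℕ j) (toℕ k) 1 1 eq) (ℕₚ.*-identityʳ (toℕ k))))

UpwardClosed : {A : Set} → (ℚ → A → Set) → Set
UpwardClosed P = ∀ {c c′} y → c ≤ℚ c′ → P c y → P c′ y

HasUniformBounds : Set → Set₁
HasUniformBounds A = (P : ℚ → A → Set) → UpwardClosed P →
  (∀ y → ∃ λ c → P c y) → ∃ λ c → ∀ y → P c y

Fin-hasUniformBounds : ∀ m → HasUniformBounds (Fin m)
Fin-hasUniformBounds ℕ.zero    P upward bound = 0ℚ , λ ()
Fin-hasUniformBounds (ℕ.suc m) P upward bound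
  with Fin-hasUniformBounds m (λ c k → P c (suc k)) (upward ∘ suc) (bound ∘ suc) | bound zero
... | c , Pc | c₀ , Pc₀ = c₀ ⊔ c , λ where
  zero    → upward zero (p≤p⊔q c₀ c) Pc₀
  (suc k) → upward (suc k) (p≤q⊔p c₀ c) (Pc k)

×-hasUniformBounds : ∀ {A B} → HasUniformBounds A → HasUniformBounds B → HasUniformBounds (A × B)
×-hasUniformBounds boundsA boundsB P upward bound
  with boundsA (λ c a → ∀ b → P c (a , b)) (λ a c≤c′ Pc b → upward (a , b) c≤c′ (Pc b))
         (λ a → boundsB (λ c b → P c (a , b)) (λ b → upward (a , b)) (λ b → bound (a , b)))
... | c , Pc = c , λ (a , b) → Pc a b

Point-hasUniformBounds : ∀ n → HasUniformBounds (Point n)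
Point-hasUniformBounds n = ×-hasUniformBounds (Fin-hasUniformBounds n) (Fin-hasUniformBounds n)

-- Pointwise, c = (D y − G y) / D y makes c * D y + G y equal to D y itself.
dominating-scale : ∀ {A} → HasUniformBounds A → (D G : A → ℚ) →
  ∃ λ c → ∀ y → (0ℚ < D y → 0ℚ < c * D y + G y) × (D y < 0ℚ → c * D y + G y < 0ℚ)
dominating-scale {A} bounds D G = bounds Dominates upward pointwise
  where
  Dominates : ℚ → A → Set
  Dominates c y = (0ℚ < D y → 0ℚ < c * D y + G y) × (D y < 0ℚ → c * D y + G y < 0ℚ)

  upward : UpwardClosed Dominates
  upward y c≤c′ (pos , neg) =
    (λ 0<Dy → <-≤-trans (pos 0<Dy)
                (+-monoˡ-≤ (G y) (*-monoʳ-≤-nonNeg (D y) {{nonNegative (<⇒≤ 0<Dy)}} c≤c′))) ,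
    (λ Dy<0 → ≤-<-trans
                (+-monoˡ-≤ (G y) (*-monoʳ-≤-nonPos (D y) {{nonPositive (<⇒≤ Dy<0)}} c≤c′)) (neg Dy<0))

  pointwise : ∀ y → ∃ λ c → Dominates c y
  pointwise y with D y ≟ 0ℚ
  ... | yes Dy≡0 = 0ℚ , (⊥-elim ∘ <-irrefl (sym Dy≡0)) , (⊥-elim ∘ <-irrefl Dy≡0)
  ... | no Dy≢0  = (d - g) * e , (λ 0<Dy → subst (0ℚ <_) (sym rescaled) 0<Dy) ,
                                 (λ Dy<0 → subst (_< 0ℚ) (sym rescaled) Dy<0)
    where
    d g e : ℚ
    d = D y
    g = G y
    e = (1/ d) {{≢-nonZero Dy≢0}}
    rescaled : (d - g) * e * d + g ≡ d
    rescaled = begin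
      (d - g) * e * d + g
        ≡⟨ solve 3 (λ d g e → (d :- g) :* e :* d :+ g := (d :- g) :* (e :* d) :+ g) refl d g e ⟩
      (d - g) * (e * d) + g
        ≡⟨ cong (λ u → (d - g) * u + g) (*-inverseˡ d {{≢-nonZero Dy≢0}}) ⟩
      (d - g) * 1ℚ + g
        ≡⟨ solve 2 (λ d g → (d :- g) :* con 1ℚ :+ g := d) refl d g ⟩
      d ∎

uniform-sign : ∀ {A : Set} (P : A → Set) (φ : A → ℚ) →
  Dec (∃ λ y → P y × 0ℚ < φ y) →
  (∀ {y z} → P y → P z → 0ℚ < φ y → φ z < 0ℚ → ⊥) →
  ∃ λ σ → ∀ y → P y → φ y ≢ 0ℚ → 0ℚ < σ * φ y
uniform-sign P φ (yes (y₀ , Py₀ , 0<φy₀)) no-opposite = 1ℚ , positive-all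
  where
  positive-all : ∀ y → P y → φ y ≢ 0ℚ → 0ℚ < 1ℚ * φ y
  positive-all y Py φy≢0 with <-cmp (φ y) 0ℚ
  ... | tri< φy<0 _ _ = ⊥-elim (no-opposite Py₀ Py 0<φy₀ φy<0)
  ... | tri≈ _ φy≡0 _ = ⊥-elim (φy≢0 φy≡0)
  ... | tri> _ _ 0<φy = subst (0ℚ <_) (sym (*-identityˡ (φ y))) 0<φy
uniform-sign P φ (no ∄positive) _ = - 1ℚ , negative-all
  where
  negative-all : ∀ y → P y → φ y ≢ 0ℚ → 0ℚ < - 1ℚ * φ y
  negative-all y Py φy≢0 with <-cmp (φ y) 0ℚ
  ... | tri< φy<0 _ _ =
    subst (0ℚ <_) (solve 1 (λ p → :- p := :- con 1ℚ :* p) refl (φ y)) (neg-antimono-< φy<0)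
  ... | tri≈ _ φy≡0 _ = ⊥-elim (φy≢0 φy≡0)
  ... | tri> _ _ 0<φy = ⊥-elim (∄positive (y , Py , 0<φy))

any?-Point : ∀ {n} {P : Point n → Set} → (∀ y → Dec (P y)) → Dec (∃ P)
any?-Point P? = map′ (λ (y₁ , y₂ , Py) → (y₁ , y₂) , Py) (λ ((y₁ , y₂) , Py) → y₁ , y₂ , Py)
  (any? λ y₁ → any? λ y₂ → P? (y₁ , y₂))

dot≡0∧cross≡0⇒≡0 : ∀ {a₁ a₂} {u₁ u₂} → ¬ (a₁ ≡ 0ℚ × a₂ ≡ 0ℚ) →
  a₁ * u₁ + a₂ * u₂ ≡ 0ℚ → a₁ * u₂ - a₂ * u₁ ≡ 0ℚ → u₁ ≡ 0ℚ × u₂ ≡ 0ℚ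
dot≡0∧cross≡0⇒≡0 {a₁} {a₂} {u₁} {u₂} a≢0 dot≡0 cross≡0 =
  *-cancelˡ-≡-pos K (trans K*u₁≡0 (sym (*-zeroʳ K))) , *-cancelˡ-≡-pos K (trans K*u₂≡0 (sym (*-zeroʳ K)))
  where
  K : ℚ
  K = a₁ * a₁ + a₂ * a₂
  instance
    _ : Positive K
    _ = positive (0<p*p+q*q a≢0)
  K*u₁≡0 : K * u₁ ≡ 0ℚ
  K*u₁≡0 = begin
    (a₁ * a₁ + a₂ * a₂) * u₁
      ≡⟨ solve 4 (λ a₁ a₂ u₁ u₂ →
           (a₁ :* a₁ :+ a₂ :* a₂) :* u₁ := a₁ :* (a₁ :* u₁ :+ a₂ :* u₂) :+ :- a₂ :* (a₁ :* u₂ :- a₂ :* u₁))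
           refl a₁ a₂ u₁ u₂ ⟩
    a₁ * (a₁ * u₁ + a₂ * u₂) + - a₂ * (a₁ * u₂ - a₂ * u₁)
      ≡⟨ zero-combination a₁ (- a₂) dot≡0 cross≡0 ⟩
    0ℚ ∎
  K*u₂≡0 : K * u₂ ≡ 0ℚ
  K*u₂≡0 = begin
    (a₁ * a₁ + a₂ * a₂) * u₂
      ≡⟨ solve 4 (λ a₁ a₂ u₁ u₂ →
           (a₁ :* a₁ :+ a₂ :* a₂) :* u₂ := a₂ :* (a₁ :* u₁ :+ a₂ :* u₂) :+ a₁ :* (a₁ :* u₂ :- a₂ :* u₁))
           refl a₁ a₂ u₁ u₂ ⟩
    a₂ * (a₁ * u₁ + a₂ * u₂) + a₁ * (a₁ * u₂ - a₂ * u₁)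
      ≡⟨ zero-combination a₂ a₁ dot≡0 cross≡0 ⟩
    0ℚ ∎

orthogonal⇒cross-proportional : ∀ {a₁ a₂} {u₁ u₂ v₁ v₂} →
  a₁ * u₁ + a₂ * u₂ ≡ 0ℚ → a₁ * v₁ + a₂ * v₂ ≡ 0ℚ →
  (a₁ * u₂ - a₂ * u₁) * v₁ ≡ (a₁ * v₂ - a₂ * v₁) * u₁ ×
  (a₁ * u₂ - a₂ * u₁) * v₂ ≡ (a₁ * v₂ - a₂ * v₁) * u₂
orthogonal⇒cross-proportional {a₁} {a₂} {u₁} {u₂} {v₁} {v₂} a·u≡0 a·v≡0 =
  p-q≡0⇒p≡q _ _ first , p-q≡0⇒p≡q _ _ second
  where
  first : (a₁ * u₂ - a₂ * u₁) * v₁ - (a₁ * v₂ - a₂ * v₁) * u₁ ≡ 0ℚ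
  first = begin
    (a₁ * u₂ - a₂ * u₁) * v₁ - (a₁ * v₂ - a₂ * v₁) * u₁
      ≡⟨ solve 6 (λ a₁ a₂ u₁ u₂ v₁ v₂ →
           (a₁ :* u₂ :- a₂ :* u₁) :* v₁ :- (a₁ :* v₂ :- a₂ :* v₁) :* u₁
           := u₂ :* (a₁ :* v₁ :+ a₂ :* v₂) :+ :- v₂ :* (a₁ :* u₁ :+ a₂ :* u₂))
           refl a₁ a₂ u₁ u₂ v₁ v₂ ⟩
    u₂ * (a₁ * v₁ + a₂ * v₂) + - v₂ * (a₁ * u₁ + a₂ * u₂)
      ≡⟨ zero-combination u₂ (- v₂) a·v≡0 a·u≡0 ⟩
    0ℚ ∎
  second : (a₁ * u₂ - a₂ * u₁) * v₂ - (a₁ * v₂ - a₂ * v₁) * u₂ ≡ 0ℚ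
  second = begin
    (a₁ * u₂ - a₂ * u₁) * v₂ - (a₁ * v₂ - a₂ * v₁) * u₂
      ≡⟨ solve 6 (λ a₁ a₂ u₁ u₂ v₁ v₂ →
           (a₁ :* u₂ :- a₂ :* u₁) :* v₂ :- (a₁ :* v₂ :- a₂ :* v₁) :* u₂
           := v₁ :* (a₁ :* u₁ :+ a₂ :* u₂) :+ :- u₁ :* (a₁ :* v₁ :+ a₂ :* v₂))
           refl a₁ a₂ u₁ u₂ v₁ v₂ ⟩
    v₁ * (a₁ * u₁ + a₂ * u₂) + - u₁ * (a₁ * v₁ + a₂ * v₂)
      ≡⟨ zero-combination v₁ (- u₁) a·u≡0 a·v≡0 ⟩
    0ℚ ∎

convex-combination : ∀ {p q} → 0ℚ < p → q < 0ℚ → Σ ℚ λ t → 0ℚ < t × t < 1ℚ ×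
  (∀ {X Y Z} → p * (Z - X) ≡ q * (Y - X) → X ≡ t * Y + (1ℚ - t) * Z)
convex-combination {p} {q} 0<p q<0 = - q * r , 0<t , t<1 , combination
  where
  instance
    _ : Positive p
    _ = positive 0<p
    _ : Positive (- q)
    _ = positive (neg-antimono-< q<0)
    _ : Positive (p - q)
    _ = positive (+-mono-< 0<p (neg-antimono-< q<0))
    _ : NonZero (p - q)
    _ = pos⇒nonZero (p - q)
  r : ℚ
  r = 1/ (p - q)
  instance
    _ : Positive r
    _ = 1/pos⇒pos (p - q)
  [p-q]r≡1 : (p - q) * r ≡ 1ℚ
  [p-q]r≡1 = *-inverseʳ (p - q)

  0<t : 0ℚ < - q * r
  0<t = positive⁻¹ (- q * r) {{pos*pos⇒pos (- q) r}}

  1-t≡pr : 1ℚ - - q * r ≡ p * r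
  1-t≡pr = begin
    1ℚ - - q * r          ≡⟨ cong (_- - q * r) [p-q]r≡1 ⟨
    (p - q) * r - - q * r ≡⟨ solve 3 (λ p q r → (p :- q) :* r :- :- q :* r := p :* r) refl p q r ⟩
    p * r                 ∎
  t<1 : - q * r < 1ℚ
  t<1 = 0<p-q⇒q<p (subst (0ℚ <_) (sym 1-t≡pr) (positive⁻¹ (p * r) {{pos*pos⇒pos p r}}))

  combination : ∀ {X Y Z} → p * (Z - X) ≡ q * (Y - X) → X ≡ - q * r * Y + (1ℚ - - q * r) * Z
  combination {X} {Y} {Z} p[Z-X]≡q[Y-X] = sym (p-q≡0⇒p≡q _ _ (begin
    - q * r * Y + (1ℚ - - q * r) * Z - X
      ≡⟨ solve 6 (λ p q r X Y Z →
           :- q :* r :* Y :+ (con 1ℚ :- :- q :* r) :* Z :- X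
           := r :* (p :* (Z :- X) :- q :* (Y :- X)) :+ (Z :- X) :* (con 1ℚ :- (p :- q) :* r))
           refl p q r X Y Z ⟩
    r * (p * (Z - X) - q * (Y - X)) + (Z - X) * (1ℚ - (p - q) * r)
      ≡⟨ zero-combination r (Z - X) (p≡q⇒p-q≡0 p[Z-X]≡q[Y-X]) (p≡q⇒p-q≡0 (sym [p-q]r≡1)) ⟩
    0ℚ ∎))

IsAffine : ∀ {n} → (Point n → ℚ) → Set
IsAffine {n} h = Σ ℚ λ b₀ → Σ ℚ λ b₁ → Σ ℚ λ b₂ → ∀ y → h y ≡ lin b₁ b₂ y - b₀

const-isAffine : ∀ {n} k → IsAffine {n} (λ _ → k)
const-isAffine k = - k , 0ℚ , 0ℚ , λ (y₁ , y₂) →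
  solve 3 (λ k u v → k := con 0ℚ :* u :+ con 0ℚ :* v :- :- k) refl k (coord y₁) (coord y₂)

+-isAffine : ∀ {n} {h h′ : Point n → ℚ} → IsAffine h → IsAffine h′ → IsAffine (λ y → h y + h′ y)
+-isAffine (b₀ , b₁ , b₂ , h≡) (c₀ , c₁ , c₂ , h′≡) = b₀ + c₀ , b₁ + c₁ , b₂ + c₂ , λ y@(y₁ , y₂) →
  trans (cong₂ _+_ (h≡ y) (h′≡ y))
    (solve 8 (λ b₀ b₁ b₂ c₀ c₁ c₂ u v →
       (b₁ :* u :+ b₂ :* v :- b₀) :+ (c₁ :* u :+ c₂ :* v :- c₀)
       := (b₁ :+ c₁) :* u :+ (b₂ :+ c₂) :* v :- (b₀ :+ c₀))
       refl b₀ b₁ b₂ c₀ c₁ c₂ (coord y₁) (coord y₂))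

*-isAffine : ∀ {n} {h : Point n → ℚ} k → IsAffine h → IsAffine (λ y → k * h y)
*-isAffine k (b₀ , b₁ , b₂ , h≡) = k * b₀ , k * b₁ , k * b₂ , λ y@(y₁ , y₂) →
  trans (cong (k *_) (h≡ y))
    (solve 6 (λ k b₀ b₁ b₂ u v → k :* (b₁ :* u :+ b₂ :* v :- b₀) := k :* b₁ :* u :+ k :* b₂ :* v :- k :* b₀)
       refl k b₀ b₁ b₂ (coord y₁) (coord y₂))

neg-isAffine : ∀ {n} {h : Point n → ℚ} → IsAffine h → IsAffine (λ y → - h y)
neg-isAffine (b₀ , b₁ , b₂ , h≡) = - b₀ , - b₁ , - b₂ , λ y@(y₁ , y₂) →
  trans (cong -_ (h≡ y))
    (solve 5 (λ b₀ b₁ b₂ u v → :- (b₁ :* u :+ b₂ :* v :- b₀) := :- b₁ :* u :+ :- b₂ :* v :- :- b₀)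
       refl b₀ b₁ b₂ (coord y₁) (coord y₂))

indicator : ∀ {A : Set} → Dec A → Fin 2
indicator (yes _) = suc zero
indicator (no _)  = zero

indicator-yes : ∀ {A : Set} (d : Dec A) → A → indicator d ≡ suc zero
indicator-yes (yes _) _ = refl
indicator-yes (no ¬a) a = ⊥-elim (¬a a)

indicator≡1 : ∀ {A : Set} (d : Dec A) → indicator d ≡ suc zero → A
indicator≡1 (yes a) _ = a

Fin2-≢⇒≡ : ∀ {a b i : Fin 2} → a ≢ i → b ≢ i → a ≡ b
Fin2-≢⇒≡ {zero}     {zero}                _   _   = refl
Fin2-≢⇒≡ {suc zero} {suc zero}            _   _   = refl
Fin2-≢⇒≡ {zero}     {suc zero} {zero}     a≢i _   = ⊥-elim (a≢i refl)
Fin2-≢⇒≡ {zero}     {suc zero} {suc zero} _   b≢i = ⊥-elim (b≢i refl)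
Fin2-≢⇒≡ {suc zero} {zero}     {zero}     _   b≢i = ⊥-elim (b≢i refl)
Fin2-≢⇒≡ {suc zero} {zero}     {suc zero} a≢i _   = ⊥-elim (a≢i refl)

Fin2-same-side⇒≡ : ∀ {a b i : Fin 2} → (a ≡ i → b ≡ i) → (a ≢ i → b ≢ i) → b ≡ a
Fin2-same-side⇒≡ {a} {b} {i} a≡i⇒b≡i a≢i⇒b≢i with a ≟ᶠ i
... | yes a≡i = trans (a≡i⇒b≡i a≡i) (sym a≡i)
... | no a≢i  = Fin2-≢⇒≡ (a≢i⇒b≢i a≢i) a≢i

threshold-of-sign : ∀ {n} (i : Fin 2) {h : Point n → ℚ} → IsAffine h →
  Σ (Fun2 n) λ g → IsThreshold g × (∀ y → h y < 0ℚ → g y ≡ i) × (∀ y → 0ℚ < h y → g y ≢ i)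
threshold-of-sign {n} (suc zero) {h} (b₀ , b₁ , b₂ , h≡) =
  g , (b₀ , b₁ , b₂ , λ y → indicator≡1 (below? y) , indicator-yes (below? y)) , negative⇒1 , positive⇒≢1
  where
  below? : ∀ y → Dec (lin b₁ b₂ y ≤ℚ b₀)
  below? y = lin b₁ b₂ y ≤? b₀
  g : Fun2 n
  g y = indicator (below? y)
  negative⇒1 : ∀ y → h y < 0ℚ → g y ≡ suc zero
  negative⇒1 y hy<0 = indicator-yes (below? y) (<⇒≤ (p-q<0⇒p<q (subst (_< 0ℚ) (h≡ y) hy<0)))
  positive⇒≢1 : ∀ y → 0ℚ < h y → g y ≢ suc zero
  positive⇒≢1 y 0<hy gy≡1 =
    <-irrefl refl (<-≤-trans (0<p-q⇒q<p (subst (0ℚ <_) (h≡ y) 0<hy)) (indicator≡1 (below? y) gy≡1))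
threshold-of-sign zero h-affine =
  let g , g-threshold , negative⇒1 , positive⇒≢1 = threshold-of-sign (suc zero) (neg-isAffine h-affine)
  in g , g-threshold ,
     (λ y hy<0 → Fin2-≢⇒≡ (positive⇒≢1 y (neg-antimono-< hy<0)) 0≢1+n) ,
     (λ y 0<hy gy≡0 → 0≢1+n (trans (sym gy≡0) (negative⇒1 y (neg-antimono-< 0<hy))))

essential-of-cut : ∀ {n} (f : Fun2 n) (i : Fin 2) (x : Point n) {h : Point n → ℚ} → IsAffine h →
  f x ≡ i → 0ℚ < h x → (∀ y → y ≢ x → f y ≡ i → h y < 0ℚ) → (∀ y → f y ≢ i → 0ℚ < h y) →
  Essential f x
essential-of-cut f i x h-affine fx≡i 0<hx negative-on-Mᵢ positive-off-Mᵢ =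
  let g , g-threshold , negative⇒i , positive⇒≢i = threshold-of-sign i h-affine
  in g , g-threshold ,
     (λ y y≢x → Fin2-same-side⇒≡ (negative⇒i y ∘ negative-on-Mᵢ y y≢x)
                                  (positive⇒≢i y ∘ positive-off-Mᵢ y)) ,
     (λ gx≡fx → positive⇒≢i x 0<hx (trans gx≡fx fx≡i))

offset₁ offset₂ : ∀ {n} → Point n → Point n → ℚ
offset₁ x y = coord (proj₁ y) - coord (proj₁ x)
offset₂ x y = coord (proj₂ y) - coord (proj₂ x)

along : ∀ {n} → Line → Point n → Point n → ℚ
along l x y = a1 l * offset₂ x y - a2 l * offset₁ x y

along-isAffine : ∀ {n} (l : Line) (x : Point n) → IsAffine (along l x)
along-isAffine l (x₁ , x₂) = a1 l * coord x₂ - a2 l * coord x₁ , - a2 l , a1 l , λ (y₁ , y₂) →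
  solve 6 (λ a₁ a₂ x₁ x₂ y₁ y₂ →
    a₁ :* (y₂ :- x₂) :- a₂ :* (y₁ :- x₁) := :- a₂ :* y₁ :+ a₁ :* y₂ :- (a₁ :* x₂ :- a₂ :* x₁))
    refl (a1 l) (a2 l) (coord x₁) (coord x₂) (coord y₁) (coord y₂)

along-self : ∀ {n} (l : Line) (x : Point n) → along l x x ≡ 0ℚ
along-self l (x₁ , x₂) =
  solve 4 (λ a₁ a₂ x₁ x₂ → a₁ :* (x₂ :- x₂) :- a₂ :* (x₁ :- x₁) := con 0ℚ)
    refl (a1 l) (a2 l) (coord x₁) (coord x₂)

onLine⇒orthogonal : ∀ {n} (l : Line) (x y : Point n) → OnLine l x → OnLine l y →
  a1 l * offset₁ x y + a2 l * offset₂ x y ≡ 0ℚ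
onLine⇒orthogonal l x@(x₁ , x₂) y@(y₁ , y₂) onx ony = begin
  a1 l * (coord y₁ - coord x₁) + a2 l * (coord y₂ - coord x₂)
    ≡⟨ solve 6 (λ a₁ a₂ x₁ x₂ y₁ y₂ →
         a₁ :* (y₁ :- x₁) :+ a₂ :* (y₂ :- x₂) := (a₁ :* y₁ :+ a₂ :* y₂) :- (a₁ :* x₁ :+ a₂ :* x₂))
         refl (a1 l) (a2 l) (coord x₁) (coord x₂) (coord y₁) (coord y₂) ⟩
  lin (a1 l) (a2 l) y - lin (a1 l) (a2 l) x ≡⟨ cong₂ _-_ ony onx ⟩
  a0 l - a0 l                               ≡⟨ +-inverseʳ (a0 l) ⟩
  0ℚ                                        ∎

along-injective : ∀ {n} (l : Line) (x y : Point n) → OnLine l x → OnLine l y → along l x y ≡ 0ℚ → y ≡ x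
along-injective l x y onx ony along≡0 =
  let offset₁≡0 , offset₂≡0 = dot≡0∧cross≡0⇒≡0 {u₁ = offset₁ x y} {offset₂ x y}
                                (nondeg l) (onLine⇒orthogonal l x y onx ony) along≡0
  in cong₂ _,_ (coord-injective (p-q≡0⇒p≡q _ _ offset₁≡0)) (coord-injective (p-q≡0⇒p≡q _ _ offset₂≡0))

along-opposite⇒between : ∀ {n} (l : Line) (x y z : Point n) → OnLine l x → OnLine l y → OnLine l z →
  0ℚ < along l x y → along l x z < 0ℚ → StrictlyBetween x y z
along-opposite⇒between l x y z onx ony onz 0<φy φz<0 =
  let t , 0<t , t<1 , combination = convex-combination 0<φy φz<0
      proportional₁ , proportional₂ =
        orthogonal⇒cross-proportional {a1 l} {a2 l} {offset₁ x y} {offset₂ x y} {offset₁ x z} {offset₂ x z}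
          (onLine⇒orthogonal l x y onx ony) (onLine⇒orthogonal l x z onx onz)
  in (λ y≡z → <-asym 0<φy (subst (λ w → along l x w < 0ℚ) (sym y≡z) φz<0)) ,
     t , 0<t , t<1 , combination proportional₁ , combination proportional₂

along-orientation : ∀ {n} (l : Line) (x : Point n) → IsVertex l x →
  ∃ λ σ → ∀ y → OnLine l y → y ≢ x → 0ℚ < σ * along l x y
along-orientation l x (onx , ¬between) =
  let σ , orients = uniform-sign (OnLine l) (along l x)
        (any?-Point λ y → (lin (a1 l) (a2 l) y ≟ a0 l) ×-dec (0ℚ <? along l x y))
        (λ {y} {z} ony onz 0<φy φz<0 →
          ¬between (y , z , ony , onz , along-opposite⇒between l x y z onx ony onz 0<φy φz<0))
  in σ , λ y ony y≢x → orients y ony (y≢x ∘ along-injective l x y onx ony)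

bump-at-vertex : ∀ {n} (l : Line) (x : Point n) → IsVertex l x →
  Σ (Point n → ℚ) λ G → IsAffine G × 0ℚ < G x × (∀ y → OnLine l y → y ≢ x → G y < 0ℚ)
bump-at-vertex {n} l x vertex =
  let σ , orients = along-orientation l x vertex
      c , dominates = dominating-scale (Point-hasUniformBounds n) (λ y → σ * along l x y) (λ _ → - 1ℚ)
  in (λ y → - (c * (σ * along l x y) + - 1ℚ)) ,
     neg-isAffine (+-isAffine (*-isAffine c (*-isAffine σ (along-isAffine l x))) (const-isAffine (- 1ℚ))) ,
     subst (0ℚ <_) (sym (bump≡1 c σ)) (positive⁻¹ 1ℚ) ,
     (λ y ony y≢x → neg-antimono-< (proj₁ (dominates y) (orients y ony y≢x)))
  where
  bump≡1 : ∀ c σ → - (c * (σ * along l x x) + - 1ℚ) ≡ 1ℚ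
  bump≡1 c σ = begin
    - (c * (σ * along l x x) + - 1ℚ)
      ≡⟨ cong (λ φ → - (c * (σ * φ) + - 1ℚ)) (along-self l x) ⟩
    - (c * (σ * 0ℚ) + - 1ℚ)
      ≡⟨ solve 2 (λ c σ → :- (c :* (σ :* con 0ℚ) :+ :- con 1ℚ) := con 1ℚ) refl c σ ⟩
    1ℚ ∎

record CutOff {n} (l : Line) (x : Point n) : Set where
  field
    cut                    : Point n → ℚ
    cut-isAffine           : IsAffine cut
    cut-positive-at-vertex : 0ℚ < cut x
    cut-negative-below     : ∀ y → y ≢ x → lin (a1 l) (a2 l) y ≤ℚ a0 l → cut y < 0ℚ
    cut-positive-above     : ∀ y → a0 l < lin (a1 l) (a2 l) y → 0ℚ < cut y

bump⇒cutOff : ∀ {n} (l : Line) (x : Point n) {G : Point n → ℚ} → OnLine l x → IsAffine G → 0ℚ < G x →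
  (∀ y → OnLine l y → y ≢ x → G y < 0ℚ) → CutOff l x
bump⇒cutOff {n} l x {G} onx G-affine 0<Gx G<0 = record
  { cut                    = h
  ; cut-isAffine           = +-isAffine (*-isAffine c D-isAffine) G-affine
  ; cut-positive-at-vertex = subst (0ℚ <_) (sym (h≡G-on-line x onx)) 0<Gx
  ; cut-negative-below     = λ y y≢x Ly≤a0 →
      [ proj₂ (dominates y) ∘ p<q⇒p-q<0
      , (λ ony → subst (_< 0ℚ) (sym (h≡G-on-line y ony)) (G<0 y ony y≢x))
      ]′ (≤⇒<⊎≡ Ly≤a0)
  ; cut-positive-above     = λ y a0<Ly → proj₁ (dominates y) (p<q⇒0<q-p a0<Ly)
  }
  where
  D : Point n → ℚ
  D y = lin (a1 l) (a2 l) y - a0 l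
  D-isAffine : IsAffine D
  D-isAffine = a0 l , a1 l , a2 l , λ _ → refl

  scale : ∃ λ c → ∀ y → (0ℚ < D y → 0ℚ < c * D y + G y) × (D y < 0ℚ → c * D y + G y < 0ℚ)
  scale = dominating-scale (Point-hasUniformBounds n) D G
  c : ℚ
  c = proj₁ scale
  dominates : ∀ y → (0ℚ < D y → 0ℚ < c * D y + G y) × (D y < 0ℚ → c * D y + G y < 0ℚ)
  dominates = proj₂ scale

  h : Point n → ℚ
  h y = c * D y + G y
  h≡G-on-line : ∀ y → OnLine l y → h y ≡ G y
  h≡G-on-line y ony = begin
    c * (lin (a1 l) (a2 l) y - a0 l) + G y ≡⟨ cong (λ L → c * (L - a0 l) + G y) ony ⟩
    c * (a0 l - a0 l) + G y                ≡⟨ cong (λ d → c * d + G y) (+-inverseʳ (a0 l)) ⟩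
    c * 0ℚ + G y                           ≡⟨ cong (_+ G y) (*-zeroʳ c) ⟩
    0ℚ + G y                               ≡⟨ +-identityˡ (G y) ⟩
    G y                                    ∎

proposition7 : (n : ℕ) → 2 ≤ n → (f : Fun2 n) → IsThreshold f →
    (i : Fin 2) → (l : Line) → IsSepLine i f l →
    (x : Point n) → IsVertex l x → InS f i x
proposition7 n _ f _ i l sep x vertex@(onx , _) =
  let G , G-affine , 0<Gx , G<0 = bump-at-vertex l x vertex
      open CutOff (bump⇒cutOff l x onx G-affine 0<Gx G<0)
      fx≡i = proj₂ (sep x) (≤-reflexive onx)
  in essential-of-cut f i x cut-isAffine fx≡i cut-positive-at-vertex
       (λ y y≢x fy≡i → cut-negative-below y y≢x (proj₁ (sep y) fy≡i))
       (λ y fy≢i → cut-positive-above y (≰⇒> (fy≢i ∘ proj₂ (sep y)))) ,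
     fx≡i
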